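{- Let $\mathcal{X}=(\mathcal{M},X,\bot)$ be a deterministic concurrent system. Let $\alpha\in X$, let $a\in\Sigma_\alpha$ and let $c\in\mathscr{C}_\alpha$ be a clique with $a\notin c$. Then for every $x\in\overline{\mathcal{M}}_\alpha$ with $C_1(x)=c$, the letter $a$ does not occur in $x$.
   Context: Trace monoid $\mathcal{M}=\langle\Sigma\mid ab=ba\text{ for }(a,b)\in I\rangle$ over finite $\Sigma$, $I$ symmetric irreflexive, $D=(\Sigma\times\Sigma)\setminus I$, unit $\varepsilon$; $x\le y$ iff $y=xz$. Cliques: traces of distinct pairwise independent letters, identified with subsets of $\Sigma$; $\mathscr{C}$ is their set. Cliques $x\to y$ if each $b\in y$ has some $a\in x$ with $(a,b)\in D$. Generalised traces: sequences $(c_i)_{i\ge1}$ of cliques with $c_i\to c_{i+1}$, ordered componentwise by inclusion; finite traces are identified with their Cartier–Foata normal forms padded with $\varepsilon$. $C_1(x)$ denotes the first clique $c_1$ of a generalised trace $x=(c_i)$, and a letter $a$ occurs in $x$ if $a\in c_i$ for some $i$. A concurrent system is $(\mathcal{M},X,\bot)$ with $X$ finite, $\bot\notin X$, right action of $\mathcal{M}$ on $X\cup\{\bot\}$ with $\bot\cdot x=\bot$. $\mathcal{M}_\alpha=\{x:\alpha\cdot x\ne\bot\}$, $\Sigma_\alpha=\Sigma\cap\mathcal{M}_\alpha$, $\mathscr{C}_\alpha=\mathscr{C}\cap\mathcal{M}_\alpha$. Deterministic: each $(\mathcal{M}_\alpha,\le)$ is a lattice. $\overline{\mathcal{M}}_\alpha$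 is the set of generalised traces $\xi$ such that every finite $x\le\xi$ lies in $\mathcal{M}_\alpha$. -}

module Defs where

open import Level using (0ℓ)
open import Data.Nat using (ℕ; suc; _<_; _≤_)
open import Data.Fin using (Fin)
open import Data.Fin.Subset using (Subset; _∈_; _∉_; _⊆_; Empty)
open import Data.Fin.Subset.Properties using (_∈?_)
open import Data.List using (List; []; _∷_; _++_; filter; allFin)
open import Data.Maybe using (Maybe; just; nothing)
open import Data.Product using (Σ; ∃; _×_; _,_)
open import Relation.Binary.PropositionalEquality using (_≡_; _≢_)
open import Relation.Nullary using (¬_)

record IndepAlphabet : Set₁ where
  field
    n        : ℕ
    I        : Fin n → Fin n → Set
    I-sym    : ∀ {a b} → I a b → I b a
    I-irrefl : ∀ a → ¬ I a a

module Traces (A : IndepAlphabet) where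
  open IndepAlphabet A

  Letter : Set
  Letter = Fin n

  -- words over Σ; traces are words up to the congruence _≈_
  Word : Set
  Word = List Letter

  D : Letter → Letter → Set
  D a b = ¬ I a b

  infix 4 _≈_
  data _≈_ : Word → Word → Set where
    ≈-refl  : ∀ {u} → u ≈ u
    ≈-sym   : ∀ {u v} → u ≈ v → v ≈ u
    ≈-trans : ∀ {u v w} → u ≈ v → v ≈ w → u ≈ w
    ≈-swap  : ∀ u {a b} v → I a b → (u ++ a ∷ b ∷ v) ≈ (u ++ b ∷ a ∷ v)

  infix 4 _≼_
  _≼_ : Word → Word → Set
  x ≼ y = ∃ λ z → y ≈ (x ++ z)

  IsClique : Subset n → Set
  IsClique c = ∀ a b → a ∈ c → b ∈ c → a ≢ b → I a b

  -- the trace of a clique: product of its letters (in increasing order;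
  -- any order gives the same trace)
  cliqueWord : Subset n → Word
  cliqueWord c = filter (λ a → a ∈? c) (allFin n)

  _⟶_ : Subset n → Subset n → Set
  x ⟶ y = ∀ b → b ∈ y → ∃ λ a → a ∈ x × D a b

  -- generalised traces: sequences (c_i)_{i ≥ 1} (indexed here from 0)
  record GenTrace : Set where
    field
      seq    : ℕ → Subset n
      clique : ∀ i → IsClique (seq i)
      chain  : ∀ i → seq i ⟶ seq (suc i)

  open GenTrace public

  _⊑_ : GenTrace → GenTrace → Set
  x ⊑ y = ∀ i → seq x i ⊆ seq y i

  C₁ : GenTrace → Subset n
  C₁ x = seq x 0

  Occurs : Letter → GenTrace → Set
  Occurs a x = ∃ λ i → a ∈ seq x i

  -- d is a finite generalised trace whose cliques vanish from index k on
  -- (i.e. a Cartier–Foata normal form padded with ε)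
  VanishesFrom : GenTrace → ℕ → Set
  VanishesFrom d k = ∀ i → k ≤ i → Empty (seq d i)

  prefixWord : GenTrace → ℕ → Word
  prefixWord d ℕ.zero    = []
  prefixWord d (suc k)   = prefixWord d k ++ cliqueWord (seq d k)

-- concurrent system (M, X, ⊥) with X = Fin m, X ∪ {⊥} = Maybe (Fin m), ⊥ = nothing,
-- and a right action of the trace monoid given on representing words.
record ConcurrentSystem (A : IndepAlphabet) : Set₁ where
  open Traces A
  field
    m        : ℕ
    act      : Maybe (Fin m) → Word → Maybe (Fin m)
    act-⊥    : ∀ w → act nothing w ≡ nothing
    act-ε    : ∀ s → act s [] ≡ s
    act-++   : ∀ s u v → act s (u ++ v) ≡ act (act s u) v
    act-≈    : ∀ s {u v} → u ≈ v → act s u ≡ act s v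

module System {A : IndepAlphabet} (S : ConcurrentSystem A) where
  open IndepAlphabet A
  open Traces A
  open ConcurrentSystem S

  InM : Fin m → Word → Set
  InM α x = act (just α) x ≢ nothing

  IsLattice : Fin m → Set
  IsLattice α =
    ∀ x y → InM α x → InM α y →
      (∃ λ j → InM α j × x ≼ j × y ≼ j ×
         (∀ z → InM α z → x ≼ z → y ≼ z → j ≼ z))
    × (∃ λ w → InM α w × w ≼ x × w ≼ y ×
         (∀ z → InM α z → z ≼ x → z ≼ y → z ≼ w))

  Deterministic : Set
  Deterministic = ∀ α → IsLattice α

  -- ξ ∈ M̄_α : every finite trace x ≤ ξ (x a padded Cartier–Foata normal form) lies in M_α
  InMbar : Fin m → GenTrace → Set
  InMbar α ξ = ∀ (d : GenTrace) (k : ℕ) → VanishesFrom d k → d ⊑ ξ → InM α (prefixWord d k)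

-- If a first occurred in the clique c_{k+1} of x, the chain condition would give a letter
-- b ∈ c_k dependent on a. The finite prefix y = c_0 ⋯ c_k lies in M_α, contains b and
-- not a, so by determinism y and a have a common upper bound a z = y w in M_α. Projecting
-- onto the pairwise dependent letters {a, b} is invariant under commutations, and it turns
-- this equation into one whose left side starts with a and whose right side starts with a
-- letter of y — impossible. Since a ∉ c_0 = c, induction on k concludes.
module Submission where

open import Defs
open import Data.Empty using (⊥-elim)
open import Function using (_∘_)
open import Data.Fin using (Fin; _≟_)
open import Data.Fin.Subset as Subset using (Subset; _∉_) renaming (_∈_ to _∈ₛ_)
open import Data.Fin.Subset.Properties using (∉⊥; _∈?_)
open import Data.List using (_∷_; _++_; [_]; filter; allFin)
open import Data.List.Properties using (filter-++; filter-accept; filter-reject; ∷-injectiveˡ)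
open import Data.List.Membership.Propositional using (_∈_)
open import Data.List.Membership.Propositional.Properties
  using (∈-filter⁺; ∈-filter⁻; ∈-allFin; ∈-++⁺ˡ; ∈-++⁺ʳ; ∈-++⁻)
open import Data.List.Relation.Unary.Any using (here)
open import Data.Nat using (ℕ; zero; suc; _<_; _<?_; s≤s)
open import Data.Nat.Induction using (<-rec)
open import Data.Nat.Properties using (≤-refl; <-trans; n<1+n; m<n⇒m<1+n; m≤n⇒m<n∨m≡n; ≤⇒≯)
open import Data.Product using (∃; _×_; _,_; proj₁; proj₂)
open import Data.Sum using (_⊎_; inj₁; inj₂)
open import Relation.Binary.PropositionalEquality
  using (_≡_; refl; sym; trans; cong; cong₂; subst; module ≡-Reasoning)
open import Relation.Nullary using (¬_; Dec; yes; no)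
open import Relation.Nullary.Decidable using (_⊎-dec_)
open import Relation.Unary using (Pred; Decidable)

module _ {a p} {X : Set a} {P : Pred X p} (P? : Decidable P) where

  filter-swap : ∀ {y z} → ¬ (P y × P z) → ∀ v →
                filter P? (y ∷ z ∷ v) ≡ filter P? (z ∷ y ∷ v)
  filter-swap {y} {z} ¬both v = by-cases (P? y) (P? z)
    where
    by-cases : Dec (P y) → Dec (P z) → filter P? (y ∷ z ∷ v) ≡ filter P? (z ∷ y ∷ v)
    by-cases (yes Py) (yes Pz) = ⊥-elim (¬both (Py , Pz))
    by-cases (yes Py) (no ¬Pz) =
      trans (filter-accept P? Py) (trans (cong (y ∷_) (filter-reject P? ¬Pz))
        (sym (trans (filter-reject P? ¬Pz) (filter-accept P? Py))))
    by-cases (no ¬Py) (yes Pz) =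
      trans (filter-reject P? ¬Py) (trans (filter-accept P? Pz)
        (sym (trans (filter-accept P? Pz) (cong (z ∷_) (filter-reject P? ¬Py)))))
    by-cases (no ¬Py) (no ¬Pz) =
      trans (filter-reject P? ¬Py) (trans (filter-reject P? ¬Pz)
        (sym (trans (filter-reject P? ¬Pz) (filter-reject P? ¬Py))))

module TraceProperties (A : IndepAlphabet) where
  open IndepAlphabet A
  open Traces A

  filter-≈ : ∀ {p} {P : Pred Letter p} (P? : Decidable P) →
             (∀ {y z} → P y → P z → ¬ I y z) →
             ∀ {u v} → u ≈ v → filter P? u ≡ filter P? v
  filter-≈ P? dep ≈-refl        = refl
  filter-≈ P? dep (≈-sym p)     = sym (filter-≈ P? dep p)
  filter-≈ P? dep (≈-trans p q) = trans (filter-≈ P? dep p) (filter-≈ P? dep q)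
  filter-≈ P? dep (≈-swap u {y} {z} v Iyz) = begin
      filter P? (u ++ y ∷ z ∷ v)            ≡⟨ filter-++ P? u (y ∷ z ∷ v) ⟩
      filter P? u ++ filter P? (y ∷ z ∷ v)  ≡⟨ cong (filter P? u ++_) swapped ⟩
      filter P? u ++ filter P? (z ∷ y ∷ v)  ≡⟨ sym (filter-++ P? u (z ∷ y ∷ v)) ⟩
      filter P? (u ++ z ∷ y ∷ v)            ∎
    where
    open ≡-Reasoning
    swapped : filter P? (y ∷ z ∷ v) ≡ filter P? (z ∷ y ∷ v)
    swapped = filter-swap P? (λ (Py , Pz) → dep Py Pz Iyz) v

  dependent-pair : ∀ {a b} → D a b → ∀ {y z} →
                      (y ≡ a ⊎ y ≡ b) → (z ≡ a ⊎ z ≡ b) → ¬ I y z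
  dependent-pair Dab (inj₁ refl) (inj₁ refl) = I-irrefl _
  dependent-pair Dab (inj₁ refl) (inj₂ refl) = Dab
  dependent-pair Dab (inj₂ refl) (inj₁ refl) = Dab ∘ I-sym
  dependent-pair Dab (inj₂ refl) (inj₂ refl) = I-irrefl _

  head-∈-++ : ∀ {a b : Letter} {s p q} → a ∷ s ≡ p ++ q → b ∈ p → a ∈ p
  head-∈-++ {p = _ ∷ _} eq _ = here (∷-injectiveˡ eq)

  dependent-¬-common-upper-bound : ∀ {a b y j} → D a b → b ∈ y → ¬ a ∈ y →
                                   [ a ] ≼ j → ¬ y ≼ j
  dependent-¬-common-upper-bound {a} {b} {y} Dab b∈y a∉y (z , j≈az) (w , j≈yw) =
    a∉y (proj₁ (∈-filter⁻ P? (head-∈-++ projected (∈-filter⁺ P? b∈y (inj₂ refl)))))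
    where
    P? : Decidable (λ x → x ≡ a ⊎ x ≡ b)
    P? x = (x ≟ a) ⊎-dec (x ≟ b)
    projected : a ∷ filter P? z ≡ filter P? y ++ filter P? w
    projected = begin
      a ∷ filter P? z         ≡⟨ sym (filter-accept P? (inj₁ refl)) ⟩
      filter P? (a ∷ z)       ≡⟨ filter-≈ P? (dependent-pair Dab) (≈-trans (≈-sym j≈az) j≈yw) ⟩
      filter P? (y ++ w)      ≡⟨ filter-++ P? y w ⟩
      filter P? y ++ filter P? w ∎
      where open ≡-Reasoning

  ∈-cliqueWord⁺ : ∀ {y s} → y ∈ₛ s → y ∈ cliqueWord s
  ∈-cliqueWord⁺ {y} {s} y∈s = ∈-filter⁺ (_∈? s) (∈-allFin y) y∈s

  ∈-cliqueWord⁻ : ∀ {y s} → y ∈ cliqueWord s → y ∈ₛ s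
  ∈-cliqueWord⁻ {s = s} = proj₂ ∘ ∈-filter⁻ (_∈? s) {xs = allFin n}

  ∈-prefixWord⁺ : ∀ d {y j k} → j < k → y ∈ₛ seq d j → y ∈ prefixWord d k
  ∈-prefixWord⁺ d {k = suc k} (s≤s j≤k) y∈ with m≤n⇒m<n∨m≡n j≤k
  ... | inj₁ j<k  = ∈-++⁺ˡ (∈-prefixWord⁺ d j<k y∈)
  ... | inj₂ refl = ∈-++⁺ʳ (prefixWord d k) (∈-cliqueWord⁺ y∈)

  ∈-prefixWord⁻ : ∀ d {y} k → y ∈ prefixWord d k → ∃ λ j → j < k × y ∈ₛ seq d j
  ∈-prefixWord⁻ d (suc k) y∈ with ∈-++⁻ (prefixWord d k) y∈
  ... | inj₁ y∈prefix = let j , j<k , y∈c = ∈-prefixWord⁻ d k y∈prefix in j , m<n⇒m<1+n j<k , y∈c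
  ... | inj₂ y∈clique = k , ≤-refl , ∈-cliqueWord⁻ y∈clique

  prefixWord-cong : ∀ {d e} k → (∀ {j} → j < k → seq d j ≡ seq e j) →
                    prefixWord d k ≡ prefixWord e k
  prefixWord-cong zero    _  = refl
  prefixWord-cong (suc k) eq =
    cong₂ _++_ (prefixWord-cong k (eq ∘ m<n⇒m<1+n)) (cong cliqueWord (eq ≤-refl))

  ⊥-isClique : IsClique Subset.⊥
  ⊥-isClique _ _ a∈⊥ = ⊥-elim (∉⊥ a∈⊥)

  ⟶⊥ : ∀ c → c ⟶ Subset.⊥
  ⟶⊥ _ _ b∈⊥ = ⊥-elim (∉⊥ b∈⊥)

  truncate : GenTrace → ℕ → GenTrace
  seq (truncate x k) j with j <? k
  ... | yes _ = seq x j
  ... | no _  = Subset.⊥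
  clique (truncate x k) j with j <? k
  ... | yes _ = clique x j
  ... | no _  = ⊥-isClique
  chain (truncate x k) j with j <? k | suc j <? k
  ... | yes _   | yes _    = chain x j
  ... | no j≮k  | yes j<k′ = ⊥-elim (j≮k (<-trans (n<1+n j) j<k′))
  ... | _       | no _     = ⟶⊥ _

  truncate-< : ∀ x {k j} → j < k → seq (truncate x k) j ≡ seq x j
  truncate-< x {k} {j} j<k with j <? k
  ... | yes _   = refl
  ... | no j≮k  = ⊥-elim (j≮k j<k)

  truncate-⊑ : ∀ x k → truncate x k ⊑ x
  truncate-⊑ x k j with j <? k
  ... | yes _ = λ y∈ → y∈
  ... | no _  = ⊥-elim ∘ ∉⊥

  truncate-vanishes : ∀ x k → VanishesFrom (truncate x k) k
  truncate-vanishes x k j k≤j with j <? k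
  ... | yes j<k = ⊥-elim (≤⇒≯ k≤j j<k)
  ... | no _    = ∉⊥ ∘ proj₂

  prefixWord-truncate : ∀ x k → prefixWord (truncate x k) k ≡ prefixWord x k
  prefixWord-truncate x k = prefixWord-cong k (truncate-< x)

module SystemProperties {A : IndepAlphabet} (S : ConcurrentSystem A) where
  open IndepAlphabet A
  open Traces A
  open ConcurrentSystem S using (m)
  open System S
  open TraceProperties A

  InMbar⇒InM-prefixWord : ∀ {α x} → InMbar α x → ∀ k → InM α (prefixWord x k)
  InMbar⇒InM-prefixWord {α} {x} x∈M̄ k =
    subst (InM α) (prefixWord-truncate x k)
      (x∈M̄ (truncate x k) k (truncate-vanishes x k) (truncate-⊑ x k))

  deterministic⇒upper-bound : Deterministic → ∀ α {u v} → InM α u → InM α v →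
                              ∃ λ j → u ≼ j × v ≼ j
  deterministic⇒upper-bound det α {u} {v} u∈M v∈M =
    let j , _ , u≼j , v≼j , _ = proj₁ (det α u v u∈M v∈M) in j , u≼j , v≼j

  module _ (det : Deterministic) (α : Fin m) (a : Letter) (a∈M : InM α [ a ])
           (x : GenTrace) (x∈M̄ : InMbar α x) where

    absent-step : ∀ k → (∀ {j} → j < suc k → a ∉ seq x j) → a ∉ seq x (suc k)
    absent-step k absent a∈ with chain x k a a∈
    ... | b , b∈ , Dba with deterministic⇒upper-bound det α a∈M (InMbar⇒InM-prefixWord x∈M̄ (suc k))
    ...   | _ , a≼j , y≼j =
      dependent-¬-common-upper-bound (Dba ∘ I-sym) (∈-prefixWord⁺ x ≤-refl b∈) a∉y a≼j y≼j
      where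
      a∉y : ¬ a ∈ prefixWord x (suc k)
      a∉y a∈y = let _ , j<1+k , a∈c = ∈-prefixWord⁻ x (suc k) a∈y in absent j<1+k a∈c

    absent-everywhere : a ∉ C₁ x → ∀ i → a ∉ seq x i
    absent-everywhere a∉C₁ = <-rec (λ i → a ∉ seq x i) absent
      where
      absent : ∀ i → (∀ {j} → j < i → a ∉ seq x j) → a ∉ seq x i
      absent zero    _ = a∉C₁
      absent (suc k)   = absent-step k

lemma2 : (A : IndepAlphabet) (S : ConcurrentSystem A) →
    System.Deterministic S →
    (α : Fin (ConcurrentSystem.m S)) →
    (a : Fin (IndepAlphabet.n A)) → System.InM S α [ a ] →
    (c : Subset (IndepAlphabet.n A)) → Traces.IsClique A c →
    System.InM S α (Traces.cliqueWord A c) → a ∉ c →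
    (x : Traces.GenTrace A) → System.InMbar S α x →
    Traces.C₁ A x ≡ c → ¬ Traces.Occurs A a x
lemma2 A S det α a a∈M c _ _ a∉c x x∈M̄ C₁x≡c (i , a∈) =
  absent-everywhere det α a a∈M x x∈M̄ (subst (a ∉_) (sym C₁x≡c) a∉c) i a∈
  where open SystemProperties S
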